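{- Let $(A,X,\perp)$ be an RS-polarity and $R_1,R_2\subseteq A\times X$ relations such that for $i\in\{1,2\}$: (1) $\forall x\in X$, $(R_i^{ -1}[x])^{\uparrow\downarrow}\subseteq R_i^{ -1}[x]$; (2) $\forall a\in A$, $(R_i[a])^{\downarrow\uparrow}\subseteq R_i[a]$; (3) $R_i\subseteq\ \perp$; (4) $\forall a\in A\,\forall x\in X\,(aR_ix\Rightarrow (R_i^{ -1}[x])^{\uparrow}\subseteq R_i[a])$. Let $\mathbb P^+$ be the complete lattice of Galois-stable subsets of $A$, and for $U\in\mathbb P^+$ let $\Box_i U=\bigcap\{R_i^{ -1}[x]\mid x\in X,\ U\subseteq x^{\downarrow}\}$. Let $S$ be the set of all composite maps $\mathbb P^+\to\mathbb P^+$ of the form $(\Box_i\Box_j)^n$ or $\Box_i(\Box_j\Box_i)^n$ with $\{i,j\}=\{1,2\}$ and $n\in\mathbb N$, define $C(u)=\bigwedge_{s\in S}s(u)$ (intersection) for $u\in\mathbb P^+$, and define $R_C\subseteq A\times X$ by $aR_Cx$ iff $a\in C(x^{\downarrow})$. Then (i) $R_C\subseteq\ \perp$, and (ii) for all $a\in A$ and $x\in X$, if $aR_Cx$ then $(R_C^{ -1}[x])^{\uparrow}\subseteq R_C[a]$.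
   Context: A polarity is a triple $(A,X,\perp)$ with $A,X$ sets and $\perp\subseteq A\times X$. For $U\subseteq A$ let $U^{\uparrow}=\{x\in X\mid \forall a\in U,\ a\perp x\}$ and for $V\subseteq X$ let $V^{\downarrow}=\{a\in A\mid \forall x\in V,\ a\perp x\}$; write $U^{\uparrow\downarrow}=(U^{\uparrow})^{\downarrow}$, $V^{\downarrow\uparrow}=(V^{\downarrow})^{\uparrow}$, $a^{\uparrow}=\{a\}^{\uparrow}$, $x^{\downarrow}=\{x\}^{\downarrow}$. $U\subseteq A$ is Galois-stable if $U^{\uparrow\downarrow}=U$; these sets, ordered by inclusion, form a complete lattice $\mathbb P^+$ with meet given by intersection. Specialization preorders: for $x,y\in X$, $x\leq y$ iff $\forall a\,(a\perp x\Rightarrow a\perp y)$; for $a,b\in A$, $a\leq b$ iff $\forall x\,(b\perp x\Rightarrow a\perp x)$. RS-polarity: separating, i.e. (s1) $a\neq b\Rightarrow a^{\uparrow}\neq b^{\uparrow}$ and (s2) $x\neq y\Rightarrow x^{\downarrow}\neq y^{\downarrow}$; and reduced, i.e. (r1) for every $a\in A$ some $x\in X$ has $a$ $\leq$-minimal in $\{b\in A\mid b\not\perp x\}$, (r2) for every $x\in X$ some $a\in A$ has $x$ $\leq$-maximal in $\{y\in X\mid a\not\perp y\}$. For a relation $R\subseteq A\times X$, $R^{ -1}[x]=\{a\mid aRx\}$ and $R[a]=\{x\mid aRx\}$. $(\cdot)^0$ denotes the identity map. -}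

module Defs where

open import Data.Nat using (ℕ; zero; suc)
open import Data.Product using (Σ; _×_; _,_)
open import Relation.Nullary using (¬_)
open import Relation.Binary.PropositionalEquality using (_≡_; _≢_)

Subset : Set → Set₁
Subset A = A → Set

Rel : Set → Set → Set₁
Rel A X = A → X → Set

_⊆_ : {A : Set} → Subset A → Subset A → Set
U ⊆ V = ∀ a → U a → V a

_⇔_ : Set → Set → Set
P ⇔ Q = (P → Q) × (Q → P)

module Polarity {A X : Set} (_⊥_ : Rel A X) where

  up : Subset A → Subset X
  up U x = ∀ a → U a → a ⊥ x

  down : Subset X → Subset A
  down V a = ∀ x → V x → a ⊥ x

  pt↑ : A → Subset X
  pt↑ a x = a ⊥ x

  pt↓ : X → Subset A
  pt↓ x a = a ⊥ x

  GaloisStable : Subset A → Set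
  GaloisStable U = (down (up U) ⊆ U) × (U ⊆ down (up U))

  _≤X_ : X → X → Set
  x ≤X y = ∀ a → a ⊥ x → a ⊥ y

  _≤A_ : A → A → Set
  a ≤A b = ∀ x → b ⊥ x → a ⊥ x

  Separating : Set
  Separating =
    (∀ a b → a ≢ b → ¬ (∀ x → (a ⊥ x) ⇔ (b ⊥ x))) ×
    (∀ x y → x ≢ y → ¬ (∀ a → (a ⊥ x) ⇔ (a ⊥ y)))

  Reduced : Set
  Reduced =
    (∀ a → Σ X λ x → (¬ (a ⊥ x)) × (∀ b → ¬ (b ⊥ x) → b ≤A a → a ≤A b)) ×
    (∀ x → Σ A λ a → (¬ (a ⊥ x)) × (∀ y → ¬ (a ⊥ y) → x ≤X y → y ≤X x))

  RSPolarity : Set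
  RSPolarity = Separating × Reduced

  preimg : Rel A X → X → Subset A
  preimg R x a = R a x

  img : Rel A X → A → Subset X
  img R a x = R a x

  Conditions : Rel A X → Set
  Conditions R =
    (∀ x → down (up (preimg R x)) ⊆ preimg R x) ×
    (∀ a → up (down (img R a)) ⊆ img R a) ×
    (∀ a x → R a x → a ⊥ x) ×
    (∀ a x → R a x → up (preimg R x) ⊆ img R a)

  box : Rel A X → Subset A → Subset A
  box R U a = ∀ x → U ⊆ pt↓ x → R a x

  iter : ℕ → (Subset A → Subset A) → Subset A → Subset A
  iter zero f U = U
  iter (suc n) f U = f (iter n f U)

  C : Rel A X → Rel A X → Subset A → Subset A
  C R₁ R₂ U a = ∀ n →
      iter n (λ V → box R₁ (box R₂ V)) U a ×
      iter n (λ V → box R₂ (box R₁ V)) U a ×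
      box R₁ (iter n (λ V → box R₂ (box R₁ V)) U) a ×
      box R₂ (iter n (λ V → box R₁ (box R₂ V)) U) a

  RC : Rel A X → Rel A X → Rel A X
  RC R₁ R₂ a x = C R₁ R₂ (pt↓ x) a

module Submission where

open import Defs
open import Data.Product using (_×_; _,_; proj₁; proj₂)
open import Data.Nat using (zero; suc)

-- Write K R a = (R[a])↓. For a Galois-closed V, a ∈ □V iff K R a ⊆ V, and by (1) and (4)
-- every □V is closed under K R. Consequently C(V) is closed under K R₁ and K R₂, and it is
-- the largest subset of V with that property. If a R_C x and y ∈ (R_C⁻¹[x])↑, then
-- C(x↓) ⊆ y↓, so C(x↓) ⊆ C(y↓) and a R_C y.

module BoxLemmas {A X : Set} (_⊥_ : Rel A X) where
  open Polarity _⊥_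

  Closed : Subset A → Set
  Closed V = down (up V) ⊆ V

  K : Rel A X → A → Subset A
  K R a = down (img R a)

  KClosed : Rel A X → Subset A → Set
  KClosed R U = ∀ a → U a → K R a ⊆ U

  pt↓-closed : ∀ x → Closed (pt↓ x)
  pt↓-closed x b b∈ = b∈ x (λ _ c⊥x → c⊥x)

  box-closed : ∀ {R V} → Conditions R → Closed (box R V)
  box-closed (preimg-closed , _) b b∈ z V⊆z↓ =
    preimg-closed z b (λ w w∈ → b∈ w (λ c c∈box → w∈ c (c∈box z V⊆z↓)))

  box-KClosed : ∀ {R V} → Conditions R → KClosed R (box R V)
  box-KClosed (preimg-closed , _ , _ , preimg↑⊆img) a a∈box b b∈K z V⊆z↓ =
    preimg-closed z b (λ w w∈ → b∈K w (preimg↑⊆img a z (a∈box z V⊆z↓) w w∈))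

  box⇒K⊆ : ∀ {R V a} → Closed V → box R V a → K R a ⊆ V
  box⇒K⊆ V-closed a∈box b b∈K =
    V-closed b (λ w w∈ → b∈K w (a∈box w (λ c c∈V → w∈ c c∈V)))

  K⊆⇒box : ∀ {R V a} → Conditions R → K R a ⊆ V → box R V a
  K⊆⇒box {a = a} (_ , img-closed , _) K⊆V z V⊆z↓ =
    img-closed a z (λ b b∈K → V⊆z↓ b (K⊆V b b∈K))

  ⊆-box : ∀ {R U V} → Conditions R → KClosed R U → U ⊆ V → U ⊆ box R V
  ⊆-box cond U-closed U⊆V a a∈U = K⊆⇒box cond (λ b b∈K → U⊆V b (U-closed a a∈U b b∈K))

  ⊆-iter : ∀ {U V} {f : Subset A → Subset A} →
    (∀ {W} → U ⊆ W → U ⊆ f W) → U ⊆ V → ∀ n → U ⊆ iter n f V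
  ⊆-iter f-mono U⊆V zero = U⊆V
  ⊆-iter f-mono U⊆V (suc n) = f-mono (⊆-iter f-mono U⊆V n)

  iter-closed : ∀ {R₁ R₂ V} → Conditions R₁ → Closed V →
    ∀ n → Closed (iter n (λ W → box R₁ (box R₂ W)) V)
  iter-closed cond₁ V-closed zero = V-closed
  iter-closed cond₁ V-closed (suc n) = box-closed cond₁

  C-⊆ : ∀ {R₁ R₂ V} → C R₁ R₂ V ⊆ V
  C-⊆ a a∈C = proj₁ (a∈C zero)

  C-swap : ∀ {R₁ R₂ V} → C R₁ R₂ V ⊆ C R₂ R₁ V
  C-swap a a∈C n with a∈C n
  ... | s₁₂ , s₂₁ , t₁ , t₂ = s₂₁ , s₁₂ , t₂ , t₁

  C-KClosed₁ : ∀ {R₁ R₂ V} → Conditions R₁ → Conditions R₂ → Closed V →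
    KClosed R₁ (C R₁ R₂ V)
  C-KClosed₁ {R₁} {R₂} {V} cond₁ cond₂ V-closed a a∈C b b∈K n =
    b∈iter n , box⇒K⊆ {R₁} (iter-closed cond₂ V-closed n) (t₁ n) b b∈K ,
    box-KClosed {R₁} cond₁ a (t₁ n) b b∈K ,
    box⇒K⊆ {R₁} (box-closed cond₂) (a∈iter (suc n)) b b∈K
    where
    a∈iter : ∀ m → iter m (λ W → box R₁ (box R₂ W)) V a
    a∈iter m = proj₁ (a∈C m)
    t₁ : ∀ m → box R₁ (iter m (λ W → box R₂ (box R₁ W)) V) a
    t₁ m = proj₁ (proj₂ (proj₂ (a∈C m)))
    b∈iter : ∀ m → iter m (λ W → box R₁ (box R₂ W)) V b
    b∈iter zero = box⇒K⊆ {R₁} V-closed (t₁ zero) b b∈K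
    b∈iter (suc m) = box-KClosed {R₁} cond₁ a (a∈iter (suc m)) b b∈K

  C-KClosed₂ : ∀ {R₁ R₂ V} → Conditions R₁ → Conditions R₂ → Closed V →
    KClosed R₂ (C R₁ R₂ V)
  C-KClosed₂ cond₁ cond₂ V-closed a a∈C b b∈K =
    C-swap b (C-KClosed₁ cond₂ cond₁ V-closed a (C-swap a a∈C) b b∈K)

  ⊆-C : ∀ {R₁ R₂ U V} → Conditions R₁ → Conditions R₂ →
    KClosed R₁ U → KClosed R₂ U → U ⊆ V → U ⊆ C R₁ R₂ V
  ⊆-C {R₁} {R₂} {U} cond₁ cond₂ U-closed₁ U-closed₂ U⊆V a a∈U n =
    ⊆-iter ⊆-box₁₂ U⊆V n a a∈U , ⊆-iter ⊆-box₂₁ U⊆V n a a∈U ,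
    ⊆-box cond₁ U-closed₁ (⊆-iter ⊆-box₂₁ U⊆V n) a a∈U ,
    ⊆-box cond₂ U-closed₂ (⊆-iter ⊆-box₁₂ U⊆V n) a a∈U
    where
    ⊆-box₁₂ : ∀ {W} → U ⊆ W → U ⊆ box R₁ (box R₂ W)
    ⊆-box₁₂ U⊆W = ⊆-box cond₁ U-closed₁ (⊆-box cond₂ U-closed₂ U⊆W)
    ⊆-box₂₁ : ∀ {W} → U ⊆ W → U ⊆ box R₂ (box R₁ W)
    ⊆-box₂₁ U⊆W = ⊆-box cond₂ U-closed₂ (⊆-box cond₁ U-closed₁ U⊆W)

mainTheorem5 : {A X : Set} (_⊥_ : Rel A X) (R₁ R₂ : Rel A X) →
    Polarity.RSPolarity _⊥_ →
    Polarity.Conditions _⊥_ R₁ →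
    Polarity.Conditions _⊥_ R₂ →
    (∀ a x → Polarity.RC _⊥_ R₁ R₂ a x → a ⊥ x) ×
    (∀ a x → Polarity.RC _⊥_ R₁ R₂ a x →
      Polarity.up _⊥_ (Polarity.preimg _⊥_ (Polarity.RC _⊥_ R₁ R₂) x)
        ⊆ Polarity.img _⊥_ (Polarity.RC _⊥_ R₁ R₂) a)
mainTheorem5 _⊥_ R₁ R₂ _ cond₁ cond₂ =
  (λ a x → C-⊆ {R₁} {R₂} {pt↓ x} a) ,
  λ a x a∈C y C⊆y↓ →
    ⊆-C cond₁ cond₂ (C-KClosed₁ cond₁ cond₂ (pt↓-closed x))
      (C-KClosed₂ cond₁ cond₂ (pt↓-closed x)) C⊆y↓ a a∈C
  where
  open Polarity _⊥_
  open BoxLemmas _⊥_
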